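{- Let $\Sigma_3\subseteq\Sigma_2\subseteq\Sigma_1$ be alphabets and $H_1,H_2,H_3$ sets of hypotheses over $\Sigma_1,\Sigma_2,\Sigma_3$ respectively. If $H_1$ reduces to $H_2$ and $H_2$ reduces to $H_3$, then $H_1$ reduces to $H_3$.
   Context: Regular expressions $T(X)$ over an alphabet $X$: $e,f::=e+f\mid e\cdot f\mid e^*\mid 0\mid 1\mid a$ ($a\in X$), with usual language $\llbracket e\rrbracket$. Kleene algebra axioms: idempotent semiring axioms plus $1+xx^*\le x^*$, $x+yz\le z\Rightarrow y^*x\le z$, $x+yz\le y\Rightarrow xz^*\le y$. A hypothesis is a pair $e\le f$. $\mathsf{KA}_H\vdash e=f$ means derivable in equational logic from all instances of the Kleene algebra axioms and the hypotheses in $H$, letters being constants (no substitution rule); $\mathsf{KA}_H\vdash H'$ means all inequations of $H'$ are derivable. The $H$-closure $H^\star(L)$ is the smallest language containing $L$ such that for all $e\le f\in H$ and words $u,v$, $u\llbracket f\rrbracket v\subseteq H^\star(L)$ implies $u\llbracket e\rrbracket v\subseteq H^\star(L)$. For $\Gamma\subseteq\Sigma$, $H$ over $\Sigma$, $H'$ over $\Gamma$: $H$ reduces to $H'$ if $\mathsf{KA}_H\vdash H'$ and there is $r:T(\Sigma)\to T(\Gamma)$ with $\mathsf{KA}_H\vdash e=r(e)$ and $H^\star(\llbracket e\rrbracket)\cap\Gamma^*\subseteq H'^\star(\llbracket r(e)\rrbracket)$ for all $e\in T(\Sigma)$. -}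

module Defs where

open import Data.List using (List; []; _∷_; _++_; map)
open import Data.Product using (Σ; _×_; _,_)

-- Alphabets are types; an inclusion Γ ⊆ Σ of alphabets is an injective map ι : Γ → Σ.

infixl 6 _⊕_
infixl 7 _⊙_
data Exp (X : Set) : Set where
  _⊕_ : Exp X → Exp X → Exp X
  _⊙_ : Exp X → Exp X → Exp X
  _⋆  : Exp X → Exp X
  𝟘   : Exp X
  𝟙   : Exp X
  var : X → Exp X

-- renaming of letters (used to view T(Γ) inside T(Σ) along Γ ⊆ Σ)
mapE : {X Y : Set} → (X → Y) → Exp X → Exp Y
mapE ι (e ⊕ f) = mapE ι e ⊕ mapE ι f
mapE ι (e ⊙ f) = mapE ι e ⊙ mapE ι f
mapE ι (e ⋆)   = mapE ι e ⋆
mapE ι 𝟘       = 𝟘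
mapE ι 𝟙       = 𝟙
mapE ι (var a) = var (ι a)

Lang : Set → Set₁
Lang X = List X → Set

data ⟦_⟧ {X : Set} : Exp X → Lang X where
  inl   : ∀ {e f w} → ⟦ e ⟧ w → ⟦ e ⊕ f ⟧ w
  inr   : ∀ {e f w} → ⟦ f ⟧ w → ⟦ e ⊕ f ⟧ w
  cat   : ∀ {e f u v} → ⟦ e ⟧ u → ⟦ f ⟧ v → ⟦ e ⊙ f ⟧ (u ++ v)
  nil   : ∀ {e} → ⟦ e ⋆ ⟧ []
  cons  : ∀ {e u v} → ⟦ e ⟧ u → ⟦ e ⋆ ⟧ v → ⟦ e ⋆ ⟧ (u ++ v)
  one   : ⟦ 𝟙 ⟧ []
  letter : ∀ {a} → ⟦ var a ⟧ (a ∷ [])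

-- A set of hypotheses over X: a predicate on pairs (e , f), read e ≤ f
Hyps : Set → Set₁
Hyps X = Exp X → Exp X → Set

-- KA_H ⊢ e = f : equational logic over all instances of the Kleene algebra
-- axioms (the two star induction axioms are Horn clauses, hence rules) and
-- the hypotheses of H; letters are constants (no substitution rule).
-- e ≤ f abbreviates e + f = f.
infix 4 _⊢_≈_ _⊢_≤_
data _⊢_≈_ {X : Set} (H : Hyps X) : Exp X → Exp X → Set

_⊢_≤_ : {X : Set} → Hyps X → Exp X → Exp X → Set
H ⊢ e ≤ f = H ⊢ e ⊕ f ≈ f

data _⊢_≈_ {X} H where
  ≈-refl  : ∀ {e} → H ⊢ e ≈ e
  ≈-sym   : ∀ {e f} → H ⊢ e ≈ f → H ⊢ f ≈ e
  ≈-trans : ∀ {e f g} → H ⊢ e ≈ f → H ⊢ f ≈ g → H ⊢ e ≈ g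
  ⊕-cong  : ∀ {e e' f f'} → H ⊢ e ≈ e' → H ⊢ f ≈ f' → H ⊢ e ⊕ f ≈ e' ⊕ f'
  ⊙-cong  : ∀ {e e' f f'} → H ⊢ e ≈ e' → H ⊢ f ≈ f' → H ⊢ e ⊙ f ≈ e' ⊙ f'
  ⋆-cong  : ∀ {e e'} → H ⊢ e ≈ e' → H ⊢ e ⋆ ≈ e' ⋆
  ⊕-assoc : ∀ {e f g} → H ⊢ (e ⊕ f) ⊕ g ≈ e ⊕ (f ⊕ g)
  ⊕-comm  : ∀ {e f} → H ⊢ e ⊕ f ≈ f ⊕ e
  ⊕-idem  : ∀ {e} → H ⊢ e ⊕ e ≈ e
  ⊕-zero  : ∀ {e} → H ⊢ e ⊕ 𝟘 ≈ e
  ⊙-assoc : ∀ {e f g} → H ⊢ (e ⊙ f) ⊙ g ≈ e ⊙ (f ⊙ g)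
  ⊙-oneˡ  : ∀ {e} → H ⊢ 𝟙 ⊙ e ≈ e
  ⊙-oneʳ  : ∀ {e} → H ⊢ e ⊙ 𝟙 ≈ e
  ⊙-zeroˡ : ∀ {e} → H ⊢ 𝟘 ⊙ e ≈ 𝟘
  ⊙-zeroʳ : ∀ {e} → H ⊢ e ⊙ 𝟘 ≈ 𝟘
  distribˡ : ∀ {e f g} → H ⊢ e ⊙ (f ⊕ g) ≈ (e ⊙ f) ⊕ (e ⊙ g)
  distribʳ : ∀ {e f g} → H ⊢ (e ⊕ f) ⊙ g ≈ (e ⊙ g) ⊕ (f ⊙ g)
  ⋆-unfold : ∀ {e} → H ⊢ 𝟙 ⊕ e ⊙ (e ⋆) ≤ e ⋆
  ⋆-indˡ   : ∀ {x y z} → H ⊢ x ⊕ y ⊙ z ≤ z → H ⊢ (y ⋆) ⊙ x ≤ z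
  ⋆-indʳ   : ∀ {x y z} → H ⊢ x ⊕ y ⊙ z ≤ y → H ⊢ x ⊙ (z ⋆) ≤ y
  hyp : ∀ {e f} → H e f → H ⊢ e ≤ f

data Closure {X : Set} (H : Hyps X) (L : Lang X) : Lang X where
  base : ∀ {w} → L w → Closure H L w
  step : ∀ {e f} → H e f → ∀ u v →
         (∀ x → ⟦ f ⟧ x → Closure H L (u ++ x ++ v)) →
         ∀ {y} → ⟦ e ⟧ y → Closure H L (u ++ y ++ v)

-- Reduction of H (over Σ) to H' (over Γ), for the alphabet inclusion ι : Γ ⊆ Σ.
-- Words of Γ* are viewed as words of Σ* via map ι; expressions via mapE ι.
Reduces : {S G : Set} (ι : G → S) → Hyps S → Hyps G → Set
Reduces {S} {G} ι H H' =
  (∀ e f → H' e f → H ⊢ mapE ι e ≤ mapE ι f)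
  × Σ (Exp S → Exp G) (λ r →
      (∀ e → H ⊢ e ≈ mapE ι (r e))
      × (∀ e (w : List G) → Closure H ⟦ e ⟧ (map ι w) → Closure H' ⟦ r e ⟧ w))

{-# OPTIONS --safe #-}
-- A KA_{H₂}
-- derivation over Σ₂ becomes a KA_{H₁} derivation over Σ₁ once every H₂
-- hypothesis is KA_{H₁}-derivable, so the two derivability conditions chain;
-- the closure conditions chain because words of Σ₃* are words of Σ₂* via j.
module Submission where

open import Defs
open import Function.Base using (_∘_)
open import Function.Definitions using (Injective)
open import Relation.Binary.PropositionalEquality using (_≡_; refl; cong; cong₂; subst; subst₂)
open import Data.List using (map)
open import Data.List.Properties using (map-∘)
open import Data.Product using (_,_)

mapE-∘ : {X Y Z : Set} (i : Y → Z) (j : X → Y) (e : Exp X) →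
         mapE i (mapE j e) ≡ mapE (i ∘ j) e
mapE-∘ i j (e ⊕ f) = cong₂ _⊕_ (mapE-∘ i j e) (mapE-∘ i j f)
mapE-∘ i j (e ⊙ f) = cong₂ _⊙_ (mapE-∘ i j e) (mapE-∘ i j f)
mapE-∘ i j (e ⋆)   = cong _⋆ (mapE-∘ i j e)
mapE-∘ i j 𝟘       = refl
mapE-∘ i j 𝟙       = refl
mapE-∘ i j (var a) = refl

module _ {S G : Set} (ι : G → S) {H : Hyps S} {H' : Hyps G}
         (derivable : ∀ e f → H' e f → H ⊢ mapE ι e ≤ mapE ι f) where

  mapE-≈ : ∀ {e f} → H' ⊢ e ≈ f → H ⊢ mapE ι e ≈ mapE ι f
  mapE-≈ ≈-refl        = ≈-refl
  mapE-≈ (≈-sym p)     = ≈-sym (mapE-≈ p)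
  mapE-≈ (≈-trans p q) = ≈-trans (mapE-≈ p) (mapE-≈ q)
  mapE-≈ (⊕-cong p q)  = ⊕-cong (mapE-≈ p) (mapE-≈ q)
  mapE-≈ (⊙-cong p q)  = ⊙-cong (mapE-≈ p) (mapE-≈ q)
  mapE-≈ (⋆-cong p)    = ⋆-cong (mapE-≈ p)
  mapE-≈ ⊕-assoc       = ⊕-assoc
  mapE-≈ ⊕-comm        = ⊕-comm
  mapE-≈ ⊕-idem        = ⊕-idem
  mapE-≈ ⊕-zero        = ⊕-zero
  mapE-≈ ⊙-assoc       = ⊙-assoc
  mapE-≈ ⊙-oneˡ        = ⊙-oneˡ
  mapE-≈ ⊙-oneʳ        = ⊙-oneʳ
  mapE-≈ ⊙-zeroˡ       = ⊙-zeroˡ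
  mapE-≈ ⊙-zeroʳ       = ⊙-zeroʳ
  mapE-≈ distribˡ      = distribˡ
  mapE-≈ distribʳ      = distribʳ
  mapE-≈ ⋆-unfold      = ⋆-unfold
  mapE-≈ (⋆-indˡ p)    = ⋆-indˡ (mapE-≈ p)
  mapE-≈ (⋆-indʳ p)    = ⋆-indʳ (mapE-≈ p)
  mapE-≈ (hyp {e} {f} p) = derivable e f p

lemma3p11 : {Σ₁ Σ₂ Σ₃ : Set} (i : Σ₂ → Σ₁) (j : Σ₃ → Σ₂)
    → Injective _≡_ _≡_ i → Injective _≡_ _≡_ j
    → (H₁ : Hyps Σ₁) (H₂ : Hyps Σ₂) (H₃ : Hyps Σ₃)
    → Reduces i H₁ H₂ → Reduces j H₂ H₃ → Reduces (i ∘ j) H₁ H₃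
lemma3p11 i j _ _ H₁ H₂ H₃ (derivable₁ , r₁ , sound₁ , closure₁)
                            (derivable₂ , r₂ , sound₂ , closure₂) =
  derivable , r₂ ∘ r₁ , sound , closure
  where
  lift : ∀ {e f} → H₂ ⊢ e ≈ f → H₁ ⊢ mapE i e ≈ mapE i f
  lift = mapE-≈ i derivable₁

  derivable : ∀ e f → H₃ e f → H₁ ⊢ mapE (i ∘ j) e ≤ mapE (i ∘ j) f
  derivable e f p =
    subst₂ (λ a b → H₁ ⊢ a ≤ b) (mapE-∘ i j e) (mapE-∘ i j f) (lift (derivable₂ e f p))

  sound : ∀ e → H₁ ⊢ e ≈ mapE (i ∘ j) (r₂ (r₁ e))
  sound e = ≈-trans (sound₁ e)
    (subst (H₁ ⊢ mapE i (r₁ e) ≈_) (mapE-∘ i j (r₂ (r₁ e))) (lift (sound₂ (r₁ e))))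

  closure : ∀ e w → Closure H₁ ⟦ e ⟧ (map (i ∘ j) w) → Closure H₃ ⟦ r₂ (r₁ e) ⟧ w
  closure e w c =
    closure₂ (r₁ e) w (closure₁ e (map j w) (subst (Closure H₁ ⟦ e ⟧) (map-∘ w) c))
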